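{- Let $n$ be a positive integer with $n\ge186$, $n\equiv1\pmod5$ and $n\equiv1\pmod6$, and let $H$ be any abelian group of order $n^2+n+1$. Then there are no inverse-closed subsets $T_0,T_1\subseteq H$ with $e\in T_0$ satisfying $T_0T_1=H-e$ and $T_0^2+T_1^2=2H-T_0^{(2)}-T_1^{(2)}+2ne$ in $\mathbb{Z}[H]$.
   Context: $H$ is written multiplicatively with identity $e$; $\mathbb{Z}[H]$ is the integral group ring, a subset $D\subseteq H$ is identified with $\sum_{g\in D}g$, and $H$ also denotes $\sum_{h\in H}h$. For $A=\sum a_gg$ and $t\in\mathbb{Z}$, $A^{(t)}=\sum a_gg^t$. Inverse-closed means $T^{(-1)}=T$. -}

module Defs where

open import Data.Nat using (ℕ; zero; suc)
open import Data.Fin using (Fin; zero; suc; _≟_)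
open import Data.Bool using (Bool; true; false; if_then_else_)
open import Data.Integer using (ℤ; +_; _+_; _*_; _-_)
open import Relation.Binary.PropositionalEquality using (_≡_)
open import Relation.Nullary using (does)
open import Algebra.Structures using (IsAbelianGroup)

-- A finite abelian group of order m, presented (up to isomorphism) on the
-- carrier Fin m with propositional equality.
record FinAbGroup (m : ℕ) : Set where
  field
    _∙_ : Fin m → Fin m → Fin m
    ε : Fin m
    _⁻¹ : Fin m → Fin m
    isAbelianGroup : IsAbelianGroup _≡_ _∙_ ε _⁻¹

Σ-Fin : (m : ℕ) → (Fin m → ℤ) → ℤ
Σ-Fin zero f = + 0
Σ-Fin (suc m) f = f zero + Σ-Fin m (λ i → f (suc i))

Subset : ℕ → Set
Subset m = Fin m → Bool

module GroupRing {m : ℕ} (G : FinAbGroup m) where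
  open FinAbGroup G

  -- elements of ℤ[H]: coefficient functions  A = Σ_g A(g) g
  ZH : Set
  ZH = Fin m → ℤ

  -- a subset D identified with Σ_{g ∈ D} g
  ⟦_⟧ : Subset m → ZH
  ⟦ D ⟧ g = if D g then + 1 else + 0

  eZ : ZH
  eZ g = if does (g ≟ ε) then + 1 else + 0

  HZ : ZH
  HZ g = + 1

  _⊕_ : ZH → ZH → ZH
  (A ⊕ B) g = A g + B g

  _⊖_ : ZH → ZH → ZH
  (A ⊖ B) g = A g - B g

  _·_ : ℤ → ZH → ZH
  (k · A) g = k * A g

  _⊛_ : ZH → ZH → ZH
  (A ⊛ B) g = Σ-Fin m (λ h → A h * B ((h ⁻¹) ∙ g))

  -- A^{(t)} = Σ a_g g^t, here for t = 2: coefficient of g is Σ_{h : h² = g} a_h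
  sq⁽²⁾ : ZH → ZH
  sq⁽²⁾ A g = Σ-Fin m (λ h → if does ((h ∙ h) ≟ g) then A h else + 0)

  InverseClosed : Subset m → Set
  InverseClosed T = ∀ h → T (h ⁻¹) ≡ T h

-- Since n ≡ 1 (mod 6), |H| = n² + n + 1 = 3 (1 + 3 s). A counting argument (McKay's) gives an element
-- z of order 3, and since 9 ∤ |H| every cube root of e lies in ⟨z⟩; so x ↦ x ^ (1 + 3 s) induces an
-- epimorphism φ : H → ℤ₃. Let χ be the character of H that sends φ⁻¹(1) to a primitive cube root of
-- unity. On inverse-closed elements χ takes integer values, χ(H) = 0, χ(e) = 1 and χ(T⁽²⁾) = χ(T), so
-- the two equations become u v = -1 and u² + v² = 2 n - u - v for u = χ(T₀), v = χ(T₁). Then v = -u = ∓1,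
-- and hence n = 1.
module Submission where

open import Defs

open import Data.Nat.Base as ℕ using (ℕ)
open import Data.Fin.Base using (Fin)
open import Relation.Binary.PropositionalEquality using (_≡_)

module IntegerSums where
  open import Data.Nat.Base using (zero; suc)
  open import Data.Fin.Base using (Fin; zero; suc)
  open import Data.Fin.Properties using (punchInᵢ≢i)
  open import Data.Fin.Permutation using (permutation)
  open import Data.Vec.Functional using (removeAt)
  open import Data.Integer.Base using (ℤ; +_; 0ℤ; -_; _+_; _-_; _*_)
  open import Data.Integer.Properties
    using (+-0-commutativeMonoid; +-*-semiring; neg-distrib-+; +-identityʳ)
  open import Function.Base using (_∘_)
  open import Relation.Binary.PropositionalEquality
  open ≡-Reasoning

  open import Algebra.Properties.CommutativeMonoid.Sum +-0-commutativeMonoid public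
  open import Algebra.Properties.Semiring.Sum +-*-semiring public
    using (*-distribˡ-sum; *-distribʳ-sum)

  Σ-Fin≡sum : ∀ m (f : Fin m → ℤ) → Σ-Fin m f ≡ sum f
  Σ-Fin≡sum zero    f = refl
  Σ-Fin≡sum (suc m) f = cong (_+_ (f zero)) (Σ-Fin≡sum m (f ∘ suc))

  *-Σ-Fin : ∀ {m} a (f : Fin m → ℤ) → a * Σ-Fin m f ≡ sum (λ i → a * f i)
  *-Σ-Fin {m} a f = trans (cong (a *_) (Σ-Fin≡sum m f)) (*-distribˡ-sum a f)

  sum-neg : ∀ {m} (f : Fin m → ℤ) → sum (λ i → - f i) ≡ - sum f
  sum-neg {zero}  f = refl
  sum-neg {suc m} f =
    trans (cong (_+_ (- f zero)) (sum-neg (f ∘ suc))) (sym (neg-distrib-+ (f zero) _))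

  sum-sub : ∀ {m} (f h : Fin m → ℤ) → sum (λ i → f i - h i) ≡ sum f - sum h
  sum-sub f h = trans (∑-distrib-+ f (λ i → - h i)) (cong (_+_ (sum f)) (sum-neg h))

  sum-linear : ∀ {m} a b (f h : Fin m → ℤ) →
               sum (λ i → a * f i - b * h i) ≡ a * sum f - b * sum h
  sum-linear a b f h = trans (sum-sub (λ i → a * f i) (λ i → b * h i))
                             (sym (cong₂ _-_ (*-distribˡ-sum a f) (*-distribˡ-sum b h)))

  sum-reindex : ∀ {m} (f : Fin m → ℤ) {ρ ρ⁻ : Fin m → Fin m} →
                (∀ x → ρ (ρ⁻ x) ≡ x) → (∀ x → ρ⁻ (ρ x) ≡ x) → sum f ≡ sum (f ∘ ρ)
  sum-reindex f ρρ⁻ ρ⁻ρ = sum-permute f (permutation _ _ ρρ⁻ ρ⁻ρ)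

  sum-zero : ∀ {m} (f : Fin m → ℤ) → (∀ i → f i ≡ 0ℤ) → sum f ≡ 0ℤ
  sum-zero {m} f f≡0 = trans (sum-cong-≗ f≡0) (sum-replicate-zero m)

  sum-single : ∀ {m} (f : Fin m → ℤ) c → (∀ i → i ≢ c → f i ≡ 0ℤ) → sum f ≡ f c
  sum-single {suc m} f c f≡0 = begin
    sum f                     ≡⟨ sum-remove f ⟩
    f c + sum (removeAt f c)  ≡⟨ cong (_+_ (f c)) (sum-zero _ (λ i → f≡0 _ (punchInᵢ≢i c i))) ⟩
    f c + 0ℤ                  ≡⟨ +-identityʳ (f c) ⟩
    f c                       ∎

  sum-const-1 : ∀ m → sum {m} (λ _ → + 1) ≡ + m
  sum-const-1 zero    = refl
  sum-const-1 (suc m) = cong (_+_ (+ 1)) (sum-const-1 m)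

module FinAbGroupProperties {m : ℕ} (G : FinAbGroup m) where
  open import Data.Nat.Base using (ℕ; zero; suc; _*_)
  open import Data.Fin.Base using (Fin)
  open import Data.Fin.Permutation using (Permutation; permutation)
  open import Data.Integer.Base using (ℤ)
  open import Algebra.Bundles using (AbelianGroup; CommutativeMonoid)
  open import Algebra.Structures using (IsAbelianGroup)
  import Algebra.Properties.CommutativeMonoid.Sum
  open import Relation.Binary.PropositionalEquality
  open ≡-Reasoning

  open IntegerSums using (sum; sum-reindex)

  open FinAbGroup G public
  open IsAbelianGroup isAbelianGroup public
    using (assoc; comm; identityˡ; identityʳ; inverseˡ; inverseʳ; ∙-congˡ; ∙-congʳ)

  abelianGroup : AbelianGroup _ _
  abelianGroup = record { isAbelianGroup = isAbelianGroup }

  open import Algebra.Properties.AbelianGroup abelianGroup public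
    using (∙-cancelˡ; ∙-cancelʳ; inverseˡ-unique; ⁻¹-involutive; ε⁻¹≈ε;
           \\-leftDividesˡ; \\-leftDividesʳ)

  private
    commutativeMonoid : CommutativeMonoid _ _
    commutativeMonoid = record
      { isCommutativeMonoid = IsAbelianGroup.isCommutativeMonoid isAbelianGroup }

  open import Algebra.Properties.CommutativeMonoid.Mult commutativeMonoid
    using (_×_; ×-assocˡ; ×-distrib-+)
  private
    module Π = Algebra.Properties.CommutativeMonoid.Sum commutativeMonoid

  infixr 25 _^_
  _^_ : Fin m → ℕ → Fin m
  x ^ k = k × x

  ^-* : ∀ x a b → (x ^ a) ^ b ≡ x ^ (b * a)
  ^-* x a b = ×-assocˡ x b a

  ∙-^ : ∀ x y k → (x ∙ y) ^ k ≡ x ^ k ∙ y ^ k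
  ∙-^ x y k = ×-distrib-+ x y k

  -- Lagrange: translating by x permutes G, so the product of all elements is multiplied by x ^ m.
  ^-order : ∀ x → x ^ m ≡ ε
  ^-order x = ∙-cancelʳ Πᴳ (x ^ m) ε (begin
    x ^ m ∙ Πᴳ               ≡⟨ ∙-congʳ (Π.sum-replicate m {x}) ⟨
    Π.sum {m} (λ _ → x) ∙ Πᴳ ≡⟨ Π.∑-distrib-+ (λ _ → x) (λ i → i) ⟨
    Π.sum (λ i → x ∙ i)      ≡⟨ Π.sum-permute (λ i → i) translation ⟨
    Πᴳ                       ≡⟨ identityˡ Πᴳ ⟨
    ε ∙ Πᴳ                   ∎)
    where
    Πᴳ : Fin m
    Πᴳ = Π.sum (λ i → i)
    translation : Permutation m m
    translation = permutation (x ∙_) ((x ⁻¹) ∙_) (\\-leftDividesˡ x) (\\-leftDividesʳ x)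

  ε^ : ∀ k → ε ^ k ≡ ε
  ε^ zero    = refl
  ε^ (suc k) = trans (identityˡ (ε ^ k)) (ε^ k)

  ^-3 : ∀ x → x ^ 3 ≡ x ∙ (x ∙ x)
  ^-3 x = cong (λ t → x ∙ (x ∙ t)) (identityʳ x)

  x³≡ε⇒x∙x∙x∙y≡y : ∀ {x} → x ^ 3 ≡ ε → ∀ y → x ∙ (x ∙ (x ∙ y)) ≡ y
  x³≡ε⇒x∙x∙x∙y≡y {x} x³≡ε y = begin
    x ∙ (x ∙ (x ∙ y))  ≡⟨ ∙-congˡ (assoc x x y) ⟨
    x ∙ ((x ∙ x) ∙ y)  ≡⟨ assoc x _ y ⟨
    (x ∙ (x ∙ x)) ∙ y  ≡⟨ ∙-congʳ (trans (sym (^-3 x)) x³≡ε) ⟩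
    ε ∙ y              ≡⟨ identityˡ y ⟩
    y                  ∎

  sum-translate : ∀ g (f : Fin m → ℤ) → sum (λ x → f (g ∙ x)) ≡ sum f
  sum-translate g f = sym (sum-reindex f (\\-leftDividesˡ g) (\\-leftDividesʳ g))

module ℤ₃ where
  open import Relation.Binary.PropositionalEquality using (_≡_; refl)

  data ℤ₃ : Set where
    0₃ 1₃ 2₃ : ℤ₃

  infixl 6 _+₃_
  _+₃_ : ℤ₃ → ℤ₃ → ℤ₃
  0₃ +₃ j  = j
  1₃ +₃ 0₃ = 1₃
  1₃ +₃ 1₃ = 2₃
  1₃ +₃ 2₃ = 0₃
  2₃ +₃ 0₃ = 2₃
  2₃ +₃ 1₃ = 0₃
  2₃ +₃ 2₃ = 1₃

  -₃_ : ℤ₃ → ℤ₃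
  -₃ 0₃ = 0₃
  -₃ 1₃ = 2₃
  -₃ 2₃ = 1₃

  -₃-inverseˡ : ∀ c → -₃ c +₃ c ≡ 0₃
  -₃-inverseˡ 0₃ = refl
  -₃-inverseˡ 1₃ = refl
  -₃-inverseˡ 2₃ = refl

  c≡c+c⇒c≡0 : ∀ c → c ≡ c +₃ c → c ≡ 0₃
  c≡c+c⇒c≡0 0₃ _ = refl
  c≡c+c⇒c≡0 1₃ ()
  c≡c+c⇒c≡0 2₃ ()

  c+d≡0⇒c≡-d : ∀ c d → c +₃ d ≡ 0₃ → c ≡ -₃ d
  c+d≡0⇒c≡-d 0₃ 0₃ _ = refl
  c+d≡0⇒c≡-d 1₃ 2₃ _ = refl
  c+d≡0⇒c≡-d 2₃ 1₃ _ = refl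
  c+d≡0⇒c≡-d 0₃ 1₃ ()
  c+d≡0⇒c≡-d 0₃ 2₃ ()
  c+d≡0⇒c≡-d 1₃ 0₃ ()
  c+d≡0⇒c≡-d 1₃ 1₃ ()
  c+d≡0⇒c≡-d 2₃ 0₃ ()
  c+d≡0⇒c≡-d 2₃ 2₃ ()

open ℤ₃

module OrbitCounting where
  open import Data.Nat.Base using (ℕ; _<_)
  open import Data.Nat.Properties using (_<?_; <-cmp; <-asym; <-trans)
  open import Data.Bool.Base using (_∧_; if_then_else_)
  open import Data.Bool.Properties using (∧-zeroʳ)
  open import Data.Integer.Base using (ℤ; +_; 0ℤ; 1ℤ; _+_; _*_)
  open import Data.Integer.Properties using (_≟_; *-identityʳ)
  open import Data.Integer.Tactic.RingSolver using (solve-∀)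
  open import Function.Base using (_∘_)
  open import Relation.Binary.Definitions using (tri<; tri≈; tri>)
  open import Relation.Nullary using (does; yes; no; contradiction)
  open import Relation.Nullary.Decidable using (dec-true; dec-false)
  open import Relation.Binary.PropositionalEquality

  leader : ℕ → ℕ → ℕ → ℤ
  leader a b c = if does (a <? b) ∧ does (a <? c) then 1ℤ else 0ℤ

  leaders : ℕ → ℕ → ℕ → ℤ
  leaders a b c = leader a b c + leader b c a + leader c a b

  leaders-rotate : ∀ a b c → leaders b c a ≡ leaders a b c
  leaders-rotate a b c = rotate (leader a b c) (leader b c a) (leader c a b)
    where
    rotate : ∀ x y z → y + z + x ≡ x + y + z
    rotate = solve-∀

  leaders-min : ∀ {a b c} → a < b → a < c → leaders a b c ≡ 1ℤ
  leaders-min {a} {b} {c} a<b a<c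
    rewrite dec-true (a <? b) a<b | dec-true (a <? c) a<c
          | dec-false (b <? a) (<-asym a<b) | dec-false (c <? a) (<-asym a<c)
          | ∧-zeroʳ (does (b <? c)) = refl

  leaders-distinct : ∀ a b c → a ≢ b → b ≢ c → a ≢ c → leaders a b c ≡ 1ℤ
  leaders-distinct a b c a≢b b≢c a≢c with <-cmp a b | <-cmp a c | <-cmp b c
  ... | tri≈ _ a≡b _ | _ | _ = contradiction a≡b a≢b
  ... | _ | tri≈ _ a≡c _ | _ = contradiction a≡c a≢c
  ... | _ | _ | tri≈ _ b≡c _ = contradiction b≡c b≢c
  ... | tri< a<b _ _ | tri< a<c _ _ | _            = leaders-min a<b a<c
  ... | tri> _ _ b<a | _            | tri< b<c _ _ = trans (sym (leaders-rotate a b c)) (leaders-min b<c b<a)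
  ... | _            | tri> _ _ c<a | tri> _ _ c<b = trans (leaders-rotate c a b) (leaders-min c<a c<b)
  ... | tri< a<b _ _ | tri> _ _ c<a | tri< b<c _ _ = contradiction (<-trans a<b b<c) (<-asym c<a)
  ... | tri> _ _ b<a | tri< a<c _ _ | tri> _ _ c<b = contradiction (<-trans b<a a<c) (<-asym c<b)

  -- Every ρ-orbit with three distinct keys has exactly one leader, the point of smallest key, so summing
  -- G over the leaders counts each orbit in its support once.
  module OrbitSum {X : Set} (S : (X → ℤ) → ℤ)
                  (S-cong : ∀ {f g} → (∀ x → f x ≡ g x) → S f ≡ S g)
                  (S-+ : ∀ f g → S (λ x → f x + g x) ≡ S f + S g)
                  (ρ : X → X) (ρ³≡id : ∀ x → ρ (ρ (ρ x)) ≡ x) (S-∘ρ : ∀ f → S (f ∘ ρ) ≡ S f)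
                  (κ : X → ℕ) where

    isLeader : X → ℤ
    isLeader x = leader (κ x) (κ (ρ x)) (κ (ρ (ρ x)))

    isLeader-orbit : ∀ x → κ x ≢ κ (ρ x) → κ (ρ x) ≢ κ (ρ (ρ x)) → κ (ρ (ρ x)) ≢ κ (ρ (ρ (ρ x))) →
                     isLeader x + isLeader (ρ x) + isLeader (ρ (ρ x)) ≡ 1ℤ
    isLeader-orbit x d₀₁ d₁₂ d₂₀ rewrite ρ³≡id x =
      leaders-distinct (κ x) (κ (ρ x)) (κ (ρ (ρ x))) d₀₁ d₁₂ (d₂₀ ∘ sym)

    sum-by-orbits : ∀ G → (∀ x → G (ρ x) ≡ G x) → (∀ x → G x ≢ 0ℤ → κ x ≢ κ (ρ x)) →
                    S G ≡ + 3 * S (λ x → G x * isLeader x)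
    sum-by-orbits G G∘ρ≡G free = begin
      S G                                      ≡⟨ S-cong split ⟩
      S (λ x → L x + L (ρ x) + L (ρ (ρ x)))    ≡⟨ S-+ _ _ ⟩
      S (λ x → L x + L (ρ x)) + S (L ∘ ρ ∘ ρ)  ≡⟨ cong (_+ S (L ∘ ρ ∘ ρ)) (S-+ L (L ∘ ρ)) ⟩
      S L + S (L ∘ ρ) + S (L ∘ ρ ∘ ρ)          ≡⟨ cong₂ (λ s t → S L + s + t) (S-∘ρ L) S-∘ρ² ⟩
      S L + S L + S L                          ≡⟨ triple (S L) ⟩
      + 3 * S L                                ∎
      where
      open ≡-Reasoning
      L : X → ℤ
      L x = G x * isLeader x
      S-∘ρ² : S (L ∘ ρ ∘ ρ) ≡ S L
      S-∘ρ² = trans (S-∘ρ (L ∘ ρ)) (S-∘ρ L)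
      triple : ∀ s → s + s + s ≡ + 3 * s
      triple = solve-∀
      distrib₃ : ∀ g a b c → g * (a + b + c) ≡ g * a + g * b + g * c
      distrib₃ = solve-∀
      split : ∀ x → G x ≡ L x + L (ρ x) + L (ρ (ρ x))
      split x rewrite G∘ρ≡G (ρ x) | G∘ρ≡G x with G x ≟ 0ℤ
      ... | yes Gx≡0 rewrite Gx≡0 = refl
      ... | no Gx≢0 = begin
        G x                                                        ≡⟨ *-identityʳ (G x) ⟨
        G x * 1ℤ                                                   ≡⟨ cong (G x *_) orbit ⟨
        G x * (isLeader x + isLeader (ρ x) + isLeader (ρ (ρ x)))   ≡⟨ distrib₃ (G x) _ _ _ ⟩
        L x + G x * isLeader (ρ x) + G x * isLeader (ρ (ρ x))      ∎
        where
        Gρx≢0 : G (ρ x) ≢ 0ℤ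
        Gρx≢0 = Gx≢0 ∘ trans (sym (G∘ρ≡G x))
        Gρρx≢0 : G (ρ (ρ x)) ≢ 0ℤ
        Gρρx≢0 = Gρx≢0 ∘ trans (sym (G∘ρ≡G (ρ x)))
        orbit : isLeader x + isLeader (ρ x) + isLeader (ρ (ρ x)) ≡ 1ℤ
        orbit = isLeader-orbit x (free x Gx≢0) (free (ρ x) Gρx≢0) (free (ρ (ρ x)) Gρρx≢0)

-- McKay's proof of Cauchy's theorem for the prime 3: ρ permutes the m ^ 2 solutions of a ∙ b ∙ c ≡ ε
-- in orbits of size 1 or 3, and its fixed points are the cube roots of ε; if 3 ∣ m their number is
-- therefore divisible by 3 and cannot be 1.
module CauchyThree {m : ℕ} (G : FinAbGroup m) where
  open import Data.Nat.Base using (ℕ)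
  open import Data.Nat.Divisibility using (_∣_; ∣1⇒≡1)
  open import Data.Fin.Base using (Fin; toℕ; combine; remQuot)
  open import Data.Fin.Properties using (_≟_; toℕ-injective; remQuot-combine; any?)
  open import Data.Integer.Base using (ℤ; +_; 0ℤ; 1ℤ; _+_; _*_)
  open import Data.Integer.Properties using (*-comm; *-identityʳ)
  open import Data.Integer.Divisibility.Signed
    using (divides; ∣ᵤ⇒∣; ∣⇒∣ᵤ; ∣m+n∣n⇒∣m; ∣m⇒∣m*n) renaming (_∣_ to _∣ℤ_)
  open import Data.Product using (∃; _×_; _,_; proj₁; proj₂; uncurry)
  open import Data.Product.Properties using (≡-dec)
  open import Data.Bool.Base using (if_then_else_)
  open import Function.Base using (_∘_)
  open import Relation.Nullary using (Dec; yes; no; does; contradiction)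
  open import Relation.Nullary.Decidable using (¬?; _×-dec_; dec-true)
  open import Relation.Binary.PropositionalEquality
  open ≡-Reasoning

  open FinAbGroupProperties G
  open IntegerSums
  open OrbitCounting using (module OrbitSum)

  Pair : Set
  Pair = Fin m × Fin m

  _≟ₚ_ : (p q : Pair) → Dec (p ≡ q)
  _≟ₚ_ = ≡-dec _≟_ _≟_

  -- (a , b) stands for the triple (a , b , (a ∙ b) ⁻¹), which ρ rotates
  ρ : Pair → Pair
  ρ (a , b) = b , (a ∙ b) ⁻¹

  ⁻¹-complement : ∀ a b → (b ∙ ((a ∙ b) ⁻¹)) ⁻¹ ≡ a
  ⁻¹-complement a b = sym (inverseˡ-unique a _ (trans (sym (assoc a b _)) (inverseʳ (a ∙ b))))

  ρ³≡id : ∀ p → ρ (ρ (ρ p)) ≡ p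
  ρ³≡id (a , b) = cong₂ _,_ (⁻¹-complement a b) (⁻¹-complement b ((a ∙ b) ⁻¹))

  S : (Pair → ℤ) → ℤ
  S f = sum (λ a → sum (λ b → f (a , b)))

  S-cong : ∀ {f g} → (∀ p → f p ≡ g p) → S f ≡ S g
  S-cong f≗g = sum-cong-≗ (λ a → sum-cong-≗ (λ b → f≗g (a , b)))

  S-+ : ∀ f g → S (λ p → f p + g p) ≡ S f + S g
  S-+ f g = trans (sum-cong-≗ (λ a → ∑-distrib-+ (λ b → f (a , b)) (λ b → g (a , b))))
                  (∑-distrib-+ (λ a → sum (λ b → f (a , b))) (λ a → sum (λ b → g (a , b))))

  S-∘ρ : ∀ f → S (f ∘ ρ) ≡ S f
  S-∘ρ f = begin
    sum (λ a → sum (λ b → f (b , (a ∙ b) ⁻¹)))  ≡⟨ ∑-comm (λ a b → f (b , ((a ∙ b) ⁻¹))) ⟩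
    sum (λ b → sum (λ a → f (b , (a ∙ b) ⁻¹)))  ≡⟨ sum-cong-≗ reindex ⟨
    S f                                          ∎
    where
    involutive : ∀ b a → (((a ∙ b) ⁻¹) ∙ b) ⁻¹ ≡ a
    involutive b a = trans (cong _⁻¹ (comm _ b)) (⁻¹-complement a b)
    reindex : ∀ b → sum (λ c → f (b , c)) ≡ sum (λ a → f (b , (a ∙ b) ⁻¹))
    reindex b = sum-reindex (λ c → f (b , c)) (involutive b) (involutive b)

  κ : Pair → ℕ
  κ = toℕ ∘ uncurry combine

  κ-injective : ∀ p q → κ p ≡ κ q → p ≡ q
  κ-injective (a , b) (c , d) κp≡κq = begin
    (a , b)                  ≡⟨ remQuot-combine a b ⟨
    remQuot m (combine a b)  ≡⟨ cong (remQuot m) (toℕ-injective κp≡κq) ⟩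
    remQuot m (combine c d)  ≡⟨ remQuot-combine c d ⟩
    (c , d)                  ∎

  fixed moved : Pair → ℤ
  fixed p = if does (ρ p ≟ₚ p) then 1ℤ else 0ℤ
  moved p = if does (ρ p ≟ₚ p) then 0ℤ else 1ℤ

  fixed+moved : ∀ p → fixed p + moved p ≡ 1ℤ
  fixed+moved p with ρ p ≟ₚ p
  ... | yes _ = refl
  ... | no _  = refl

  ρ-fixed-invariant : ∀ p → does (ρ (ρ p) ≟ₚ ρ p) ≡ does (ρ p ≟ₚ p)
  ρ-fixed-invariant p with ρ (ρ p) ≟ₚ ρ p | ρ p ≟ₚ p
  ... | yes _      | yes _    = refl
  ... | no _       | no _     = refl
  ... | no ρρp≢ρp  | yes ρp≡p = contradiction (cong ρ ρp≡p) ρρp≢ρp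
  ... | yes ρρp≡ρp | no ρp≢p  =
    contradiction (sym (trans (sym (ρ³≡id p)) (trans (cong ρ ρρp≡ρp) ρρp≡ρp))) ρp≢p

  moved-free : ∀ p → moved p ≢ 0ℤ → κ p ≢ κ (ρ p)
  moved-free p moved≢0 κp≡κρp with ρ p ≟ₚ p
  ... | yes _   = moved≢0 refl
  ... | no ρp≢p = ρp≢p (sym (κ-injective _ _ κp≡κρp))

  fixed⇒cube-root : ∀ {a b} → ρ (a , b) ≡ (a , b) → b ≡ a × a ^ 3 ≡ ε
  fixed⇒cube-root {a} {b} ρp≡p = b≡a , (begin
    a ^ 3                   ≡⟨ ^-3 a ⟩
    a ∙ (a ∙ a)             ≡⟨ comm a _ ⟩
    (a ∙ a) ∙ a             ≡⟨ ∙-congˡ a≡[aa]⁻¹ ⟩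
    (a ∙ a) ∙ ((a ∙ a) ⁻¹)  ≡⟨ inverseʳ (a ∙ a) ⟩
    ε                       ∎)
    where
    b≡a : b ≡ a
    b≡a = cong proj₁ ρp≡p
    a≡[aa]⁻¹ : a ≡ (a ∙ a) ⁻¹
    a≡[aa]⁻¹ = trans (sym b≡a) (trans (sym (cong proj₂ ρp≡p)) (cong (λ c → (a ∙ c) ⁻¹) b≡a))

  S-fixed : (∀ a → a ^ 3 ≡ ε → a ≡ ε) → S fixed ≡ 1ℤ
  S-fixed trivial = begin
    S fixed                    ≡⟨ sum-single (λ a → sum (λ b → fixed (a , b))) ε row≡0 ⟩
    sum (λ b → fixed (ε , b))  ≡⟨ sum-single (λ b → fixed (ε , b)) ε column≡0 ⟩
    fixed (ε , ε)              ≡⟨ cong (λ d → if d then 1ℤ else 0ℤ) (dec-true (_ ≟ₚ _) ρεε≡εε) ⟩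
    1ℤ                         ∎
    where
    fixed≡0 : ∀ p → p ≢ (ε , ε) → fixed p ≡ 0ℤ
    fixed≡0 (a , b) p≢εε with ρ (a , b) ≟ₚ (a , b)
    ... | no _     = refl
    ... | yes ρp≡p = contradiction (cong₂ _,_ a≡ε (trans b≡a a≡ε)) p≢εε
      where
      b≡a : b ≡ a
      b≡a = proj₁ (fixed⇒cube-root ρp≡p)
      a≡ε : a ≡ ε
      a≡ε = trivial a (proj₂ (fixed⇒cube-root ρp≡p))
    row≡0 : ∀ a → a ≢ ε → sum (λ b → fixed (a , b)) ≡ 0ℤ
    row≡0 a a≢ε = sum-zero (λ b → fixed (a , b)) (λ b → fixed≡0 (a , b) (a≢ε ∘ cong proj₁))
    column≡0 : ∀ b → b ≢ ε → fixed (ε , b) ≡ 0ℤ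
    column≡0 b b≢ε = fixed≡0 (ε , b) (b≢ε ∘ cong proj₂)
    ρεε≡εε : ρ (ε , ε) ≡ (ε , ε)
    ρεε≡εε = cong (ε ,_) (trans (cong _⁻¹ (identityˡ ε)) ε⁻¹≈ε)

  open OrbitSum S S-cong S-+ ρ ρ³≡id S-∘ρ κ

  3∣S-moved : + 3 ∣ℤ S moved
  3∣S-moved = divides (S (λ p → moved p * isLeader p))
                      (trans (sum-by-orbits moved moved-invariant moved-free) (*-comm (+ 3) _))
    where
    moved-invariant : ∀ p → moved (ρ p) ≡ moved p
    moved-invariant p = cong (λ d → if d then 0ℤ else 1ℤ) (ρ-fixed-invariant p)

  3∣S-one : 3 ∣ m → + 3 ∣ℤ S (λ _ → 1ℤ)
  3∣S-one 3∣m =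
    subst (+ 3 ∣ℤ_) m*m≡S-one (∣m⇒∣m*n (sum {m} (λ _ → 1ℤ)) (∣ᵤ⇒∣ {+ 3} {+ m} 3∣m))
    where
    m*m≡S-one : + m * sum {m} (λ _ → 1ℤ) ≡ S (λ _ → 1ℤ)
    m*m≡S-one = begin
      + m * sum {m} (λ _ → 1ℤ)  ≡⟨ *-distribˡ-sum {m} (+ m) (λ _ → 1ℤ) ⟩
      sum {m} (λ _ → + m * 1ℤ)  ≡⟨ sum-cong-≗ {m} (λ _ → *-identityʳ (+ m)) ⟩
      sum {m} (λ _ → + m)       ≡⟨ sum-cong-≗ {m} (λ _ → sum-const-1 m) ⟨
      S (λ _ → 1ℤ)              ∎

  cauchy₃ : 3 ∣ m → ∃ λ z → z ≢ ε × z ^ 3 ≡ ε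
  cauchy₃ 3∣m with any? (λ a → ¬? (a ≟ ε) ×-dec (a ^ 3 ≟ ε))
  ... | yes z = z
  ... | no none = contradiction (∣1⇒≡1 (∣⇒∣ᵤ 3∣1)) (λ ())
    where
    trivial : ∀ a → a ^ 3 ≡ ε → a ≡ ε
    trivial a a³≡ε with a ≟ ε
    ... | yes a≡ε = a≡ε
    ... | no a≢ε  = contradiction (a , a≢ε , a³≡ε) none
    S-one-split : S (λ _ → 1ℤ) ≡ S fixed + S moved
    S-one-split = trans (S-cong (λ p → sym (fixed+moved p))) (S-+ fixed moved)
    3∣1 : + 3 ∣ℤ 1ℤ
    3∣1 = subst (+ 3 ∣ℤ_) (S-fixed trivial)
                (∣m+n∣n⇒∣m (subst (+ 3 ∣ℤ_) S-one-split (3∣S-one 3∣m)) 3∣S-moved)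

module CyclicOfOrderThree {m : ℕ} (G : FinAbGroup m) where
  open import Data.Nat.Base using (ℕ; _⊓_)
  open import Data.Nat.Properties using (⊓-sel; ⊓-comm; ⊓-assoc)
  open import Data.Nat.Divisibility using (_∣_)
  open import Data.Fin.Base using (Fin; toℕ)
  open import Data.Fin.Properties using (_≟_; toℕ-injective)
  open import Data.Integer.Base using (ℤ; +_; 1ℤ; _*_)
  open import Data.Integer.Tactic.RingSolver using (solve-∀)
  open import Data.Integer.Divisibility.Signed using (divides; ∣⇒∣ᵤ)
  open import Data.Product using (∃; _,_)
  open import Data.Sum using (inj₁; inj₂)
  open import Function.Base using (_∘_)
  open import Relation.Nullary using (Dec; yes; no; ¬_; contradiction)
  open import Relation.Binary.PropositionalEquality
  open ≡-Reasoning

  open FinAbGroupProperties G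
  open IntegerSums
  open OrbitCounting using (module OrbitSum)

  module Generated (z : Fin m) (z≢ε : z ≢ ε) (z³≡ε : z ^ 3 ≡ ε) where

    ι : ℤ₃ → Fin m
    ι 0₃ = ε
    ι 1₃ = z
    ι 2₃ = z ∙ z

    zzz≡ε : z ∙ (z ∙ z) ≡ ε
    zzz≡ε = trans (sym (^-3 z)) z³≡ε

    zz≢ε : z ∙ z ≢ ε
    zz≢ε zz≡ε = z≢ε (trans (sym (identityʳ z)) (trans (∙-congˡ (sym zz≡ε)) zzz≡ε))

    ι-+ : ∀ c d → ι (c +₃ d) ≡ ι c ∙ ι d
    ι-+ 0₃ d  = sym (identityˡ (ι d))
    ι-+ 1₃ 0₃ = sym (identityʳ z)
    ι-+ 1₃ 1₃ = refl
    ι-+ 1₃ 2₃ = sym zzz≡ε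
    ι-+ 2₃ 0₃ = sym (identityʳ (z ∙ z))
    ι-+ 2₃ 1₃ = sym (trans (comm _ z) zzz≡ε)
    ι-+ 2₃ 2₃ = sym (trans (assoc z z (z ∙ z)) (trans (∙-congˡ zzz≡ε) (identityʳ z)))

    ι-injective : ∀ c d → ι c ≡ ι d → c ≡ d
    ι-injective 0₃ 0₃ _ = refl
    ι-injective 1₃ 1₃ _ = refl
    ι-injective 2₃ 2₃ _ = refl
    ι-injective 0₃ 1₃ e = contradiction (sym e) z≢ε
    ι-injective 0₃ 2₃ e = contradiction (sym e) zz≢ε
    ι-injective 1₃ 0₃ e = contradiction e z≢ε
    ι-injective 2₃ 0₃ e = contradiction e zz≢ε
    ι-injective 1₃ 2₃ e = contradiction (∙-cancelˡ z z ε (trans (sym e) (sym (identityʳ z)))) z≢ε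
    ι-injective 2₃ 1₃ e = contradiction (∙-cancelˡ z z ε (trans e (sym (identityʳ z)))) z≢ε

    ι-solve : ∀ {c d g} → ι d ∙ g ≡ ι c → g ≡ ι (-₃ d +₃ c)
    ι-solve {c} {d} {g} e = begin
      g                     ≡⟨ identityˡ g ⟨
      ε ∙ g                 ≡⟨ ∙-congʳ (trans (sym (ι-+ (-₃ d) d)) (cong ι (-₃-inverseˡ d))) ⟨
      (ι (-₃ d) ∙ ι d) ∙ g  ≡⟨ assoc _ _ g ⟩
      ι (-₃ d) ∙ (ι d ∙ g)  ≡⟨ ∙-congˡ e ⟩
      ι (-₃ d) ∙ ι c        ≡⟨ ι-+ (-₃ d) c ⟨
      ι (-₃ d +₃ c)         ∎

    _∈⟨z⟩ : Fin m → Set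
    g ∈⟨z⟩ = ∃ λ c → g ≡ ι c

    _∈⟨z⟩? : ∀ g → Dec (g ∈⟨z⟩)
    g ∈⟨z⟩? with g ≟ ι 0₃ | g ≟ ι 1₃ | g ≟ ι 2₃
    ... | yes g≡ι | _ | _ = yes (0₃ , g≡ι)
    ... | _ | yes g≡ι | _ = yes (1₃ , g≡ι)
    ... | _ | _ | yes g≡ι = yes (2₃ , g≡ι)
    ... | no g≢ι₀ | no g≢ι₁ | no g≢ι₂ = no λ where
      (0₃ , g≡ι) → g≢ι₀ g≡ι
      (1₃ , g≡ι) → g≢ι₁ g≡ι
      (2₃ , g≡ι) → g≢ι₂ g≡ι

    μ : Fin m → ℕ
    μ x = toℕ (ι 0₃ ∙ x) ⊓ (toℕ (ι 1₃ ∙ x) ⊓ toℕ (ι 2₃ ∙ x))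

    μ-attained : ∀ x → ∃ λ c → μ x ≡ toℕ (ι c ∙ x)
    μ-attained x with ⊓-sel (toℕ (ι 0₃ ∙ x)) (toℕ (ι 1₃ ∙ x) ⊓ toℕ (ι 2₃ ∙ x))
    ... | inj₁ μ≡₀ = 0₃ , μ≡₀
    ... | inj₂ μ≡₁₂ with ⊓-sel (toℕ (ι 1₃ ∙ x)) (toℕ (ι 2₃ ∙ x))
    ...   | inj₁ μ≡₁ = 1₃ , trans μ≡₁₂ μ≡₁
    ...   | inj₂ μ≡₂ = 2₃ , trans μ≡₁₂ μ≡₂

    ι-∙z : ∀ c x → ι c ∙ (z ∙ x) ≡ ι (c +₃ 1₃) ∙ x
    ι-∙z c x = trans (sym (assoc (ι c) z x)) (∙-congʳ (sym (ι-+ c 1₃)))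

    μ-∙z : ∀ x → μ (z ∙ x) ≡ μ x
    μ-∙z x rewrite ι-∙z 0₃ x | ι-∙z 1₃ x | ι-∙z 2₃ x = ⊓-rotate _ _ _
      where
      ⊓-rotate : ∀ a b c → b ⊓ (c ⊓ a) ≡ a ⊓ (b ⊓ c)
      ⊓-rotate a b c =
        trans (⊓-comm b (c ⊓ a)) (trans (⊓-assoc c a b) (trans (⊓-comm c (a ⊓ b)) (⊓-assoc a b c)))

    μ-≡⇒∈⟨z⟩ : ∀ g x → μ x ≡ μ (g ∙ x) → g ∈⟨z⟩
    μ-≡⇒∈⟨z⟩ g x μx≡μgx with μ-attained x | μ-attained (g ∙ x)
    ... | c , μx≡ | d , μgx≡ = -₃ d +₃ c , ι-solve {c} {d} (∙-cancelʳ x _ _ (begin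
      (ι d ∙ g) ∙ x  ≡⟨ assoc _ g x ⟩
      ι d ∙ (g ∙ x)  ≡⟨ toℕ-injective (trans (sym μgx≡) (trans (sym μx≡μgx) μx≡)) ⟩
      ι c ∙ x        ∎))

    -- A cube root w outside ⟨z⟩ gives a subgroup ⟨z , w⟩ of order 9 acting freely on G: counting first
    -- by w-orbits of cosets of ⟨z⟩ (key μ) and then by z-orbits (key toℕ) shows 9 ∣ m.
    outside⇒9∣m : ∀ w → w ^ 3 ≡ ε → ¬ w ∈⟨z⟩ → 9 ∣ m
    outside⇒9∣m w w³≡ε w∉⟨z⟩ = ∣⇒∣ᵤ (divides K (begin
      + m
        ≡⟨ sum-const-1 m ⟨
      sum {m} (λ _ → 1ℤ)
        ≡⟨ W.sum-by-orbits (λ _ → 1ℤ) (λ _ → refl) (λ x _ → w-free x) ⟩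
      + 3 * sum (λ x → 1ℤ * W.isLeader x)
        ≡⟨ cong (+ 3 *_) (Z.sum-by-orbits (λ x → 1ℤ * W.isLeader x) isLeaderW-∙z (λ x _ → z-free x)) ⟩
      + 3 * (+ 3 * K)
        ≡⟨ nine K ⟩
      K * + 9 ∎))
      where
      module W = OrbitSum (sum {m}) sum-cong-≗ ∑-distrib-+
                          (w ∙_) (x³≡ε⇒x∙x∙x∙y≡y w³≡ε) (sum-translate w) μ
      module Z = OrbitSum (sum {m}) sum-cong-≗ ∑-distrib-+
                          (z ∙_) (x³≡ε⇒x∙x∙x∙y≡y z³≡ε) (sum-translate z) toℕ
      K : ℤ
      K = sum (λ x → 1ℤ * W.isLeader x * Z.isLeader x)
      nine : ∀ k → + 3 * (+ 3 * k) ≡ k * + 9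
      nine = solve-∀
      w-free : ∀ x → μ x ≢ μ (w ∙ x)
      w-free x = w∉⟨z⟩ ∘ μ-≡⇒∈⟨z⟩ w x
      z-free : ∀ x → toℕ x ≢ toℕ (z ∙ x)
      z-free x x≡zx = z≢ε (∙-cancelʳ x z ε (trans (sym (toℕ-injective x≡zx)) (sym (identityˡ x))))
      w∙z∙ : ∀ x → w ∙ (z ∙ x) ≡ z ∙ (w ∙ x)
      w∙z∙ x = trans (sym (assoc w z x)) (trans (∙-congʳ (comm w z)) (assoc z w x))
      isLeaderW-∙z : ∀ x → 1ℤ * W.isLeader (z ∙ x) ≡ 1ℤ * W.isLeader x
      isLeaderW-∙z x
        rewrite w∙z∙ x | w∙z∙ (w ∙ x) | μ-∙z x | μ-∙z (w ∙ x) | μ-∙z (w ∙ (w ∙ x)) = refl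

    cube-root∈⟨z⟩ : ¬ 9 ∣ m → ∀ w → w ^ 3 ≡ ε → w ∈⟨z⟩
    cube-root∈⟨z⟩ 9∤m w w³≡ε with w ∈⟨z⟩?
    ... | yes w∈⟨z⟩ = w∈⟨z⟩
    ... | no w∉⟨z⟩  = contradiction (outside⇒9∣m w w³≡ε w∉⟨z⟩) 9∤m

-- For |G| = 3 (1 + 3 s) the map x ↦ x ^ (1 + 3 s) retracts G onto its unique subgroup of order 3.
module ProjectionOntoℤ₃ {m : ℕ} (G : FinAbGroup m) (s : ℕ) (m≡ : m ≡ 3 ℕ.* ℕ.suc (3 ℕ.* s))
  where
  open import Data.Nat.Base using (ℕ; suc; _*_)
  open import Data.Nat.Properties using (*-comm; +-comm)
  open import Data.Nat.Divisibility
    using (_∣_; divides; ∣1⇒≡1; *-cancelˡ-∣; ∣m+n∣m⇒∣n; m∣m*n)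
  open import Data.Fin.Base using (Fin)
  open import Data.Product using (∃; _×_; proj₁; proj₂)
  open import Relation.Nullary using (¬_; contradiction)
  open import Relation.Binary.PropositionalEquality
  open ≡-Reasoning

  open FinAbGroupProperties G
  open CauchyThree G using (cauchy₃)
  open CyclicOfOrderThree G using (module Generated)

  private
    M : ℕ
    M = suc (3 * s)

    3∣m : 3 ∣ m
    3∣m = divides M (trans m≡ (*-comm 3 M))

    9∤m : ¬ 9 ∣ m
    9∤m 9∣m = contradiction (∣1⇒≡1 3∣1) (λ ())
      where
      3∣M : 3 ∣ M
      3∣M = *-cancelˡ-∣ 3 (subst (9 ∣_) m≡ 9∣m)
      3∣1 : 3 ∣ 1
      3∣1 = ∣m+n∣m⇒∣n (subst (3 ∣_) (+-comm 1 (3 * s)) 3∣M) (m∣m*n s)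

    cauchy : ∃ λ z → z ≢ ε × z ^ 3 ≡ ε
    cauchy = cauchy₃ 3∣m

  z : Fin m
  z = proj₁ cauchy

  private
    z³≡ε : z ^ 3 ≡ ε
    z³≡ε = proj₂ (proj₂ cauchy)

  open Generated z (proj₁ (proj₂ cauchy)) z³≡ε

  private
    ^M-cube : ∀ x → (x ^ M) ^ 3 ≡ ε
    ^M-cube x = trans (^-* x M 3) (trans (cong (x ^_) (sym m≡)) (^-order x))

  φ : Fin m → ℤ₃
  φ x = proj₁ (cube-root∈⟨z⟩ 9∤m (x ^ M) (^M-cube x))

  private
    φ-spec : ∀ x → x ^ M ≡ ι (φ x)
    φ-spec x = proj₂ (cube-root∈⟨z⟩ 9∤m (x ^ M) (^M-cube x))

  φ-hom : ∀ x y → φ (x ∙ y) ≡ φ x +₃ φ y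
  φ-hom x y = ι-injective _ _ (begin
    ι (φ (x ∙ y))        ≡⟨ φ-spec (x ∙ y) ⟨
    (x ∙ y) ^ M          ≡⟨ ∙-^ x y M ⟩
    x ^ M ∙ y ^ M        ≡⟨ cong₂ _∙_ (φ-spec x) (φ-spec y) ⟩
    ι (φ x) ∙ ι (φ y)    ≡⟨ ι-+ (φ x) (φ y) ⟨
    ι (φ x +₃ φ y)       ∎)

  φ-z : φ z ≡ 1₃
  φ-z = ι-injective _ _ (begin
    ι (φ z)              ≡⟨ φ-spec z ⟨
    z ∙ z ^ (3 * s)      ≡⟨ ∙-congˡ z^3s≡ε ⟩
    z ∙ ε                ≡⟨ identityʳ z ⟩
    z                    ∎)
    where
    z^3s≡ε : z ^ (3 * s) ≡ ε
    z^3s≡ε = begin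
      z ^ (3 * s)   ≡⟨ cong (z ^_) (*-comm 3 s) ⟩
      z ^ (s * 3)   ≡⟨ ^-* z 3 s ⟨
      (z ^ 3) ^ s   ≡⟨ cong (_^ s) z³≡ε ⟩
      ε ^ s         ≡⟨ ε^ s ⟩
      ε             ∎

module IntegerFacts where
  open import Data.Nat.Base using (zero; suc)
  open import Data.Nat.Properties using (m*n≡1⇒m≡1)
  open import Data.Integer.Base using (ℤ; +_; -[1+_]; 0ℤ; 1ℤ; -1ℤ; -_; _+_; _-_; _*_; ∣_∣)
  open import Data.Integer.Properties using (*-identityˡ; -1*i≡-i; abs-*; neg-injective)
  open import Data.Integer.Tactic.RingSolver using (solve-∀)
  open import Relation.Binary.PropositionalEquality
  open ≡-Reasoning

  i≡-i⇒i≡0 : ∀ {i} → i ≡ - i → i ≡ 0ℤ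
  i≡-i⇒i≡0 {+ zero}    _ = refl
  i≡-i⇒i≡0 {+ suc _}   ()
  i≡-i⇒i≡0 { -[1+ _ ]} ()

  i*j≡-1⇒i+j≡0 : ∀ i j → i * j ≡ -1ℤ → i + j ≡ 0ℤ
  i*j≡-1⇒i+j≡0 i j ij≡-1 = go i ∣i∣≡1 ij≡-1
    where
    ∣i∣≡1 : ∣ i ∣ ≡ 1
    ∣i∣≡1 = m*n≡1⇒m≡1 ∣ i ∣ ∣ j ∣ (trans (sym (abs-* i j)) (cong ∣_∣ ij≡-1))
    go : ∀ i → ∣ i ∣ ≡ 1 → i * j ≡ -1ℤ → i + j ≡ 0ℤ
    go (+ 1)           _ ij≡-1 = cong (_+_ 1ℤ) (trans (sym (*-identityˡ j)) ij≡-1)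
    go -[1+ 0 ]        _ ij≡-1 = cong (_+_ -1ℤ) (neg-injective (trans (sym (-1*i≡-i j)) ij≡-1))
    go (+ 0)           () _
    go (+ suc (suc _)) () _
    go -[1+ suc _ ]    () _

  i*j≡-1⇒i²+j²+i+j≡2 : ∀ i j → i * j ≡ -1ℤ → i * i + j * j + i + j ≡ + 2
  i*j≡-1⇒i²+j²+i+j≡2 i j ij≡-1 = begin
    i * i + j * j + i + j                        ≡⟨ complete i j ⟩
    (i + j) * (i + j) + (i + j) - + 2 * (i * j)  ≡⟨ cong₂ (λ s p → s * s + s - + 2 * p) i+j≡0 ij≡-1 ⟩
    + 2                                          ∎
    where
    i+j≡0 : i + j ≡ 0ℤ
    i+j≡0 = i*j≡-1⇒i+j≡0 i j ij≡-1
    complete : ∀ i j → i * i + j * j + i + j ≡ (i + j) * (i + j) + (i + j) - + 2 * (i * j)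
    complete = solve-∀

module Character {m : ℕ} (G : FinAbGroup m) (φ : Fin m → ℤ₃)
                 (φ-hom : ∀ x y → φ (FinAbGroup._∙_ G x y) ≡ φ x +₃ φ y) where
  open import Data.Fin.Properties using (_≟_)
  open import Data.Bool.Base using (if_then_else_)
  open import Data.Integer.Base using (ℤ; +_; 0ℤ; 1ℤ; -1ℤ; -_; _+_; _-_; _*_)
  open import Data.Integer.Properties using (*-zeroʳ; *-identityˡ; *-distribˡ-+; neg-distribˡ-*; -1*i≡-i)
  open import Data.Integer.Tactic.RingSolver using (solve-∀)
  open import Relation.Nullary using (does)
  open import Relation.Nullary.Decidable using (dec-true; dec-false)
  open import Function.Base using (_∘_)
  open import Relation.Binary.PropositionalEquality
  open ≡-Reasoning

  open FinAbGroupProperties G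
  open GroupRing G
  open IntegerSums
  open IntegerFacts using (i≡-i⇒i≡0; i*j≡-1⇒i²+j²+i+j≡2)

  -- With ω a primitive cube root of unity and ω = -1 - ω², ω ^ c = ψ c + δ c * ω², so the character
  -- A ↦ Σ A g ω ^ (φ g) of ℤ[G] is χ A + χ′ A ω², where χ′ vanishes on inverse-invariant elements.
  ψ δ : ℤ₃ → ℤ
  ψ 0₃ = 1ℤ
  ψ 1₃ = -1ℤ
  ψ 2₃ = 0ℤ
  δ 0₃ = 0ℤ
  δ 1₃ = -1ℤ
  δ 2₃ = 1ℤ

  ψ-+ : ∀ c d → ψ (c +₃ d) ≡ ψ c * ψ d - δ c * δ d
  ψ-+ 0₃ 0₃ = refl
  ψ-+ 0₃ 1₃ = refl
  ψ-+ 0₃ 2₃ = refl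
  ψ-+ 1₃ 0₃ = refl
  ψ-+ 1₃ 1₃ = refl
  ψ-+ 1₃ 2₃ = refl
  ψ-+ 2₃ 0₃ = refl
  ψ-+ 2₃ 1₃ = refl
  ψ-+ 2₃ 2₃ = refl

  ψ-double : ∀ c → ψ (c +₃ c) ≡ 1ℤ * ψ c - 1ℤ * δ c
  ψ-double 0₃ = refl
  ψ-double 1₃ = refl
  ψ-double 2₃ = refl

  δ-neg : ∀ c → δ (-₃ c) ≡ - δ c
  δ-neg 0₃ = refl
  δ-neg 1₃ = refl
  δ-neg 2₃ = refl

  φ-ε : φ ε ≡ 0₃
  φ-ε = c≡c+c⇒c≡0 (φ ε) (trans (cong φ (sym (identityˡ ε))) (φ-hom ε ε))

  φ-⁻¹ : ∀ x → φ (x ⁻¹) ≡ -₃ φ x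
  φ-⁻¹ x =
    c+d≡0⇒c≡-d (φ (x ⁻¹)) (φ x) (trans (sym (φ-hom (x ⁻¹) x)) (trans (cong φ (inverseˡ x)) φ-ε))

  χ χ′ : ZH → ℤ
  χ A = sum (λ g → ψ (φ g) * A g)
  χ′ A = sum (λ g → δ (φ g) * A g)

  InverseInvariant : ZH → Set
  InverseInvariant A = ∀ g → A (g ⁻¹) ≡ A g

  ⟦⟧-inverseInvariant : ∀ {T} → InverseClosed T → InverseInvariant ⟦ T ⟧
  ⟦⟧-inverseInvariant T-inv g = cong (λ b → if b then 1ℤ else 0ℤ) (T-inv g)

  χ-cong : ∀ {A B} → (∀ g → A g ≡ B g) → χ A ≡ χ B
  χ-cong A≗B = sum-cong-≗ (λ g → cong (ψ (φ g) *_) (A≗B g))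

  χ-⊕ : ∀ A B → χ (A ⊕ B) ≡ χ A + χ B
  χ-⊕ A B = trans (sum-cong-≗ (λ g → *-distribˡ-+ (ψ (φ g)) (A g) (B g)))
                  (∑-distrib-+ (λ g → ψ (φ g) * A g) (λ g → ψ (φ g) * B g))

  χ-⊖ : ∀ A B → χ (A ⊖ B) ≡ χ A - χ B
  χ-⊖ A B = trans (sum-cong-≗ (λ g → distrib (ψ (φ g)) (A g) (B g)))
                  (sum-sub (λ g → ψ (φ g) * A g) (λ g → ψ (φ g) * B g))
    where
    distrib : ∀ p x y → p * (x - y) ≡ p * x - p * y
    distrib = solve-∀

  χ-· : ∀ k A → χ (k · A) ≡ k * χ A
  χ-· k A = trans (sum-cong-≗ (λ g → swap (ψ (φ g)) k (A g)))
                  (sym (*-distribˡ-sum k (λ g → ψ (φ g) * A g)))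
    where
    swap : ∀ p k x → p * (k * x) ≡ k * (p * x)
    swap = solve-∀

  χ-e : χ eZ ≡ 1ℤ
  χ-e = begin
    χ eZ            ≡⟨ sum-single _ ε off-ε ⟩
    ψ (φ ε) * eZ ε  ≡⟨ cong₂ _*_ (cong ψ φ-ε) (cong (λ b → if b then 1ℤ else 0ℤ) (dec-true (ε ≟ ε) refl)) ⟩
    1ℤ              ∎
    where
    off-ε : ∀ g → g ≢ ε → ψ (φ g) * eZ g ≡ 0ℤ
    off-ε g g≢ε rewrite dec-false (g ≟ ε) g≢ε = *-zeroʳ (ψ (φ g))

  χ′≡0 : ∀ B → InverseInvariant B → χ′ B ≡ 0ℤ
  χ′≡0 B B-inv = i≡-i⇒i≡0 (begin
    χ′ B                                 ≡⟨ sum-reindex _ ⁻¹-involutive ⁻¹-involutive ⟩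
    sum (λ g → δ (φ (g ⁻¹)) * B (g ⁻¹))  ≡⟨ sum-cong-≗ (λ g → cong₂ _*_ (δφ-⁻¹ g) (B-inv g)) ⟩
    sum (λ g → - δ (φ g) * B g)          ≡⟨ sum-cong-≗ (λ g → neg-distribˡ-* (δ (φ g)) (B g)) ⟨
    sum (λ g → - (δ (φ g) * B g))        ≡⟨ sum-neg (λ g → δ (φ g) * B g) ⟩
    - χ′ B                               ∎)
    where
    δφ-⁻¹ : ∀ g → δ (φ (g ⁻¹)) ≡ - δ (φ g)
    δφ-⁻¹ g = trans (cong δ (φ-⁻¹ g)) (δ-neg (φ g))

  χ-combination : ∀ B → InverseInvariant B → ∀ a b →
                  sum (λ g → (a * ψ (φ g) - b * δ (φ g)) * B g) ≡ a * χ B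
  χ-combination B B-inv a b = begin
    sum (λ g → (a * ψ (φ g) - b * δ (φ g)) * B g)
      ≡⟨ sum-cong-≗ (λ g → expand a b (ψ (φ g)) (δ (φ g)) (B g)) ⟩
    sum (λ g → a * (ψ (φ g) * B g) - b * (δ (φ g) * B g))
      ≡⟨ sum-linear a b (λ g → ψ (φ g) * B g) (λ g → δ (φ g) * B g) ⟩
    a * χ B - b * χ′ B
      ≡⟨ cong (λ t → a * χ B - b * t) (χ′≡0 B B-inv) ⟩
    a * χ B - b * 0ℤ
      ≡⟨ drop a b (χ B) ⟩
    a * χ B ∎
    where
    expand : ∀ a b p q x → (a * p - b * q) * x ≡ a * (p * x) - b * (q * x)
    expand = solve-∀
    drop : ∀ a b x → a * x - b * 0ℤ ≡ a * x
    drop = solve-∀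

  χ-shift : ∀ B → InverseInvariant B → ∀ c → sum (λ g → ψ (c +₃ φ g) * B g) ≡ ψ c * χ B
  χ-shift B B-inv c = trans (sum-cong-≗ (λ g → cong (_* B g) (ψ-+ c (φ g))))
                            (χ-combination B B-inv (ψ c) (δ c))

  χ-H : ∀ u → φ u ≡ 1₃ → χ HZ ≡ 0ℤ
  χ-H u φu≡1 = i≡-i⇒i≡0 (begin
    χ HZ                              ≡⟨ sum-translate u (λ g → ψ (φ g) * HZ g) ⟨
    sum (λ g → ψ (φ (u ∙ g)) * HZ g)  ≡⟨ sum-cong-≗ (λ g → cong (λ c → ψ c * HZ g) (φ-u∙ g)) ⟩
    sum (λ g → ψ (1₃ +₃ φ g) * HZ g)  ≡⟨ χ-shift HZ (λ _ → refl) 1₃ ⟩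
    -1ℤ * χ HZ                        ≡⟨ -1*i≡-i (χ HZ) ⟩
    - χ HZ                            ∎)
    where
    φ-u∙ : ∀ g → φ (u ∙ g) ≡ 1₃ +₃ φ g
    φ-u∙ g = trans (φ-hom u g) (cong (_+₃ φ g) φu≡1)

  χ-⊛ : ∀ A B → InverseInvariant B → χ (A ⊛ B) ≡ χ A * χ B
  χ-⊛ A B B-inv = begin
    sum (λ g → ψ (φ g) * Σ-Fin m (λ h → A h * B ((h ⁻¹) ∙ g)))
      ≡⟨ sum-cong-≗ (λ g → *-Σ-Fin (ψ (φ g)) (λ h → A h * B ((h ⁻¹) ∙ g))) ⟩
    sum (λ g → sum (λ h → ψ (φ g) * (A h * B ((h ⁻¹) ∙ g))))
      ≡⟨ ∑-comm (λ g h → ψ (φ g) * (A h * B ((h ⁻¹) ∙ g))) ⟩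
    sum (λ h → sum (λ g → ψ (φ g) * (A h * B ((h ⁻¹) ∙ g))))
      ≡⟨ sum-cong-≗ (λ h → trans (sum-cong-≗ (λ g → swap (ψ (φ g)) (A h) (B ((h ⁻¹) ∙ g))))
                                 (sym (*-distribˡ-sum (A h) (λ g → ψ (φ g) * B ((h ⁻¹) ∙ g))))) ⟩
    sum (λ h → A h * sum (λ g → ψ (φ g) * B ((h ⁻¹) ∙ g)))
      ≡⟨ sum-cong-≗ (λ h → cong (A h *_) (translated h)) ⟩
    sum (λ h → A h * (ψ (φ h) * χ B))
      ≡⟨ sum-cong-≗ (λ h → rearrange (A h) (ψ (φ h)) (χ B)) ⟩
    sum (λ h → ψ (φ h) * A h * χ B)
      ≡⟨ *-distribʳ-sum (χ B) (λ h → ψ (φ h) * A h) ⟨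
    χ A * χ B ∎
    where
    swap : ∀ p a b → p * (a * b) ≡ a * (p * b)
    swap = solve-∀
    rearrange : ∀ a p x → a * (p * x) ≡ p * a * x
    rearrange = solve-∀
    translated : ∀ h → sum (λ g → ψ (φ g) * B ((h ⁻¹) ∙ g)) ≡ ψ (φ h) * χ B
    translated h = begin
      sum (λ g → ψ (φ g) * B ((h ⁻¹) ∙ g))
        ≡⟨ sum-translate h (λ g → ψ (φ g) * B ((h ⁻¹) ∙ g)) ⟨
      sum (λ g → ψ (φ (h ∙ g)) * B ((h ⁻¹) ∙ (h ∙ g)))
        ≡⟨ sum-cong-≗ (λ g → cong₂ _*_ (cong ψ (φ-hom h g)) (cong B (\\-leftDividesʳ h g))) ⟩
      sum (λ g → ψ (φ h +₃ φ g) * B g)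
        ≡⟨ χ-shift B B-inv (φ h) ⟩
      ψ (φ h) * χ B ∎

  χ-sq⁽²⁾ : ∀ A → InverseInvariant A → χ (sq⁽²⁾ A) ≡ χ A
  χ-sq⁽²⁾ A A-inv = begin
    sum (λ g → ψ (φ g) * Σ-Fin m (λ h → [ h ∙ h ≟ g ]A h))
      ≡⟨ sum-cong-≗ (λ g → *-Σ-Fin (ψ (φ g)) (λ h → [ h ∙ h ≟ g ]A h)) ⟩
    sum (λ g → sum (λ h → ψ (φ g) * [ h ∙ h ≟ g ]A h))
      ≡⟨ ∑-comm (λ g h → ψ (φ g) * [ h ∙ h ≟ g ]A h) ⟩
    sum (λ h → sum (λ g → ψ (φ g) * [ h ∙ h ≟ g ]A h))
      ≡⟨ sum-cong-≗ (λ h → sum-single (λ g → ψ (φ g) * [ h ∙ h ≟ g ]A h) (h ∙ h) (off-square h)) ⟩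
    sum (λ h → ψ (φ (h ∙ h)) * [ h ∙ h ≟ h ∙ h ]A h)
      ≡⟨ sum-cong-≗ (λ h → cong₂ _*_ (cong ψ (φ-hom h h)) (on-square h)) ⟩
    sum (λ h → ψ (φ h +₃ φ h) * A h)
      ≡⟨ sum-cong-≗ (λ h → cong (_* A h) (ψ-double (φ h))) ⟩
    sum (λ h → (1ℤ * ψ (φ h) - 1ℤ * δ (φ h)) * A h)
      ≡⟨ χ-combination A A-inv 1ℤ 1ℤ ⟩
    1ℤ * χ A
      ≡⟨ *-identityˡ (χ A) ⟩
    χ A ∎
    where
    [_≟_]A : Fin m → Fin m → Fin m → ℤ
    [ x ≟ g ]A h = if does (x ≟ g) then A h else 0ℤ
    off-square : ∀ h g → g ≢ h ∙ h → ψ (φ g) * [ h ∙ h ≟ g ]A h ≡ 0ℤ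
    off-square h g g≢hh rewrite dec-false ((h ∙ h) ≟ g) (g≢hh ∘ sym) = *-zeroʳ (ψ (φ g))
    on-square : ∀ h → [ h ∙ h ≟ h ∙ h ]A h ≡ A h
    on-square h rewrite dec-true ((h ∙ h) ≟ (h ∙ h)) refl = refl

  equations⇒scalar≡2 :
    ∀ u → φ u ≡ 1₃ → ∀ {T₀ T₁ k} → InverseClosed T₀ → InverseClosed T₁ →
    (∀ g → (⟦ T₀ ⟧ ⊛ ⟦ T₁ ⟧) g ≡ (HZ ⊖ eZ) g) →
    (∀ g → ((⟦ T₀ ⟧ ⊛ ⟦ T₀ ⟧) ⊕ (⟦ T₁ ⟧ ⊛ ⟦ T₁ ⟧)) g
           ≡ (((((+ 2) · HZ) ⊖ sq⁽²⁾ ⟦ T₀ ⟧) ⊖ sq⁽²⁾ ⟦ T₁ ⟧) ⊕ (k · eZ)) g) →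
    k ≡ + 2
  equations⇒scalar≡2 u φu≡1 {T₀} {T₁} {k} T₀-inv T₁-inv product squares = begin
    k
      ≡⟨ split k (χ A₀) (χ A₁) ⟩
    k - χ A₀ - χ A₁ + χ A₀ + χ A₁
      ≡⟨ cong (λ t → t + χ A₀ + χ A₁) χ-squares ⟨
    χ A₀ * χ A₀ + χ A₁ * χ A₁ + χ A₀ + χ A₁
      ≡⟨ i*j≡-1⇒i²+j²+i+j≡2 (χ A₀) (χ A₁) χ-product ⟩
    + 2 ∎
    where
    split : ∀ k a b → k ≡ k - a - b + a + b
    split = solve-∀
    A₀ A₁ : ZH
    A₀ = ⟦ T₀ ⟧
    A₁ = ⟦ T₁ ⟧
    inv₀ : InverseInvariant A₀
    inv₀ = ⟦⟧-inverseInvariant T₀-inv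
    inv₁ : InverseInvariant A₁
    inv₁ = ⟦⟧-inverseInvariant T₁-inv
    χ-product : χ A₀ * χ A₁ ≡ -1ℤ
    χ-product = begin
      χ A₀ * χ A₁  ≡⟨ χ-⊛ A₀ A₁ inv₁ ⟨
      χ (A₀ ⊛ A₁)  ≡⟨ χ-cong product ⟩
      χ (HZ ⊖ eZ)  ≡⟨ χ-⊖ HZ eZ ⟩
      χ HZ - χ eZ  ≡⟨ cong₂ _-_ (χ-H u φu≡1) χ-e ⟩
      -1ℤ          ∎
    χ-squares : χ A₀ * χ A₀ + χ A₁ * χ A₁ ≡ k - χ A₀ - χ A₁
    χ-squares = begin
      χ A₀ * χ A₀ + χ A₁ * χ A₁
        ≡⟨ cong₂ _+_ (χ-⊛ A₀ A₀ inv₀) (χ-⊛ A₁ A₁ inv₁) ⟨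
      χ (A₀ ⊛ A₀) + χ (A₁ ⊛ A₁)
        ≡⟨ χ-⊕ (A₀ ⊛ A₀) (A₁ ⊛ A₁) ⟨
      χ ((A₀ ⊛ A₀) ⊕ (A₁ ⊛ A₁))
        ≡⟨ χ-cong squares ⟩
      χ (((((+ 2) · HZ) ⊖ sq⁽²⁾ A₀) ⊖ sq⁽²⁾ A₁) ⊕ (k · eZ))
        ≡⟨ χ-⊕ ((((+ 2) · HZ) ⊖ sq⁽²⁾ A₀) ⊖ sq⁽²⁾ A₁) (k · eZ) ⟩
      χ ((((+ 2) · HZ) ⊖ sq⁽²⁾ A₀) ⊖ sq⁽²⁾ A₁) + χ (k · eZ)
        ≡⟨ cong₂ _+_ (χ-⊖ (((+ 2) · HZ) ⊖ sq⁽²⁾ A₀) (sq⁽²⁾ A₁)) (χ-· k eZ) ⟩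
      χ (((+ 2) · HZ) ⊖ sq⁽²⁾ A₀) - χ (sq⁽²⁾ A₁) + k * χ eZ
        ≡⟨ cong₂ (λ x y → x - y + k * χ eZ) (χ-⊖ ((+ 2) · HZ) (sq⁽²⁾ A₀)) (χ-sq⁽²⁾ A₁ inv₁) ⟩
      χ ((+ 2) · HZ) - χ (sq⁽²⁾ A₀) - χ A₁ + k * χ eZ
        ≡⟨ cong₂ (λ x y → x - y - χ A₁ + k * χ eZ) χ-2H (χ-sq⁽²⁾ A₀ inv₀) ⟩
      + 2 * 0ℤ - χ A₀ - χ A₁ + k * χ eZ
        ≡⟨ cong (λ e → + 2 * 0ℤ - χ A₀ - χ A₁ + k * e) χ-e ⟩
      + 2 * 0ℤ - χ A₀ - χ A₁ + k * 1ℤ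
        ≡⟨ tidy k (χ A₀) (χ A₁) ⟩
      k - χ A₀ - χ A₁ ∎
      where
      χ-2H : χ ((+ 2) · HZ) ≡ + 2 * 0ℤ
      χ-2H = trans (χ-· (+ 2) HZ) (cong (+ 2 *_) (χ-H u φu≡1))
      tidy : ∀ k a b → + 2 * 0ℤ - a - b + k * 1ℤ ≡ k - a - b
      tidy = solve-∀

open import Data.Nat using (ℕ; _+_; _*_; _≤_; _%_)
open import Data.Integer using (+_)
open import Data.Bool using (true)
open import Data.Product using (Σ; _×_)
open import Relation.Nullary using (¬_)
open import Relation.Binary.PropositionalEquality using (_≡_)

open import Data.Nat using (suc; s≤s)
open import Data.Nat.DivMod using (_/_; m≡m%n+[m/n]*n)
open import Data.Nat.Properties using (*-cancelˡ-≡)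
open import Data.Nat.Tactic.RingSolver using (solve-∀)
open import Data.Integer.Properties using (+-injective)
open import Data.Product using (∃; _,_; proj₁; proj₂)
open import Relation.Binary.PropositionalEquality using (trans; cong; subst)

order≡3[1+3s] : ∀ n → n % 6 ≡ 1 → ∃ λ s → n * n + n + 1 ≡ 3 * suc (3 * s)
order≡3[1+3s] n n%6≡1 =
  2 * q + 4 * (q * q) , trans (cong (λ t → t * t + t + 1) n≡1+q*6) (expand q)
  where
  q : ℕ
  q = n / 6
  n≡1+q*6 : n ≡ 1 + q * 6
  n≡1+q*6 = trans (m≡m%n+[m/n]*n n 6) (cong (_+ q * 6) n%6≡1)
  expand : ∀ q → (1 + q * 6) * (1 + q * 6) + (1 + q * 6) + 1 ≡ 3 * suc (3 * (2 * q + 4 * (q * q)))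
  expand = solve-∀

proposition7p3 : (n : ℕ) → 186 ≤ n → n % 5 ≡ 1 → n % 6 ≡ 1 →
    (G : FinAbGroup (n * n + n + 1)) →
    let open FinAbGroup G
        open GroupRing G
    in ¬ (Σ (Subset (n * n + n + 1)) λ T₀ → Σ (Subset (n * n + n + 1)) λ T₁ →
          InverseClosed T₀ × InverseClosed T₁ × T₀ ε ≡ true ×
          (∀ g → (⟦ T₀ ⟧ ⊛ ⟦ T₁ ⟧) g ≡ (HZ ⊖ eZ) g) ×
          (∀ g → ((⟦ T₀ ⟧ ⊛ ⟦ T₀ ⟧) ⊕ (⟦ T₁ ⟧ ⊛ ⟦ T₁ ⟧)) g
                 ≡ (((((+ 2) · HZ) ⊖ sq⁽²⁾ ⟦ T₀ ⟧) ⊖ sq⁽²⁾ ⟦ T₁ ⟧) ⊕ ((+ (2 * n)) · eZ)) g))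
proposition7p3 n 186≤n _ n%6≡1 G (T₀ , T₁ , T₀-inv , T₁-inv , _ , product , squares) =
  186≰1 (subst (186 ≤_) n≡1 186≤n)
  where
  order : ∃ λ s → n * n + n + 1 ≡ 3 * suc (3 * s)
  order = order≡3[1+3s] n n%6≡1
  open ProjectionOntoℤ₃ G (proj₁ order) (proj₂ order)
  open Character G φ φ-hom
  2n≡2 : + (2 * n) ≡ + 2
  2n≡2 = equations⇒scalar≡2 z φ-z T₀-inv T₁-inv product squares
  n≡1 : n ≡ 1
  n≡1 = *-cancelˡ-≡ n 1 2 (+-injective 2n≡2)
  186≰1 : ¬ 186 ≤ 1
  186≰1 (s≤s ())
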